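{- Let $f:\mathbb{F}_{2^n}\to\mathbb{F}_{2^n}$ be APN. Then \[|\mathrm{Im}(f)|\geq \begin{cases}\frac{2^n+1}{3} & n \text{ odd},\\ \frac{2^n+2}{3} & n\text{ even}.\end{cases}\] If $n$ is odd and $|\mathrm{Im}(f)|=\frac{2^n+1}{3}$, then $\omega(y_0)=2$ for one element $y_0\in\mathrm{Im}(f)$ and $\omega(y)=3$ for all $y\in\mathrm{Im}(f)\setminus\{y_0\}$. If $n$ is even and $|\mathrm{Im}(f)|=\frac{2^n+2}{3}$, then one of the following occurs: 1. $\omega(y_0)=1$ for one element $y_0\in\mathrm{Im}(f)$ and $\omega(y)=3$ for all $y\in\mathrm{Im}(f)\setminus\{y_0\}$, i.e. $f$ is almost-3-to-1; 2. $\omega(y_0)=\omega(y_1)=2$ for two elements $y_0,y_1\in\mathrm{Im}(f)$ and $\omega(y)=3$ for all $y\in\mathrm{Im}(f)\setminus\{y_0,y_1\}$; 3. $\omega(y_i)=2$ for three elements $y_0,y_1,y_2\in\mathrm{Im}(f)$, $\omega(y_3)=4$ for a unique $y_3\in\mathrm{Im}(f)\setminus\{y_0,y_1,y_2\}$, and $\omega(y)=3$ for all $y\in\mathrm{Im}(f)\setminus\{y_0,\dots,y_3\}$.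
   Context: A map $f:\mathbb{F}_{2^n}\to\mathbb{F}_{2^n}$ is APN if for every $a\neq 0$ and every $b$ the equation $f(x+a)+f(x)=b$ has at most 2 solutions. $\mathrm{Im}(f)$ is the image set of $f$ and $\omega(y)=|f^{ -1}(\{y\})|$. A map is almost-3-to-1 if there is a unique element of $\mathrm{Im}(f)$ with exactly one preimage and every other element of $\mathrm{Im}(f)$ has exactly 3 preimages. -}

module Defs where

open import Data.Nat using (ℕ; zero; suc; _+_; _*_; _^_; _≤_; _%_)
open import Data.Bool using (Bool; true; false; _xor_)
import Data.Bool.Properties as BoolP
open import Data.Vec using (Vec; []; _∷_; zipWith)
import Data.Vec.Properties as VecP
open import Data.List using (List; []; _∷_; _++_; map; filter; length)
open import Data.Product using (Σ; ∃; _×_; _,_)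
open import Relation.Binary.PropositionalEquality using (_≡_)
open import Relation.Binary.Definitions using (DecidableEquality)

-- The field F_{2^n}, seen through its additive group (F_2)^n:
-- elements are bit vectors of length n, addition is componentwise xor.
-- (APN-ness, image sizes and preimage counts only use the additive structure.)
F : ℕ → Set
F n = Vec Bool n

_⊕_ : ∀ {n} → F n → F n → F n
_⊕_ = zipWith _xor_

_≟F_ : ∀ {n} → DecidableEquality (F n)
_≟F_ = VecP.≡-dec BoolP._≟_

allF : (n : ℕ) → List (F n)
allF zero = [] ∷ []
allF (suc n) = map (false ∷_) (allF n) ++ map (true ∷_) (allF n)

nSol : ∀ {n} → (F n → F n) → F n → F n → ℕ
nSol {n} f a b = length (filter (λ x → (f (x ⊕ a) ⊕ f x) ≟F b) (allF n))

zeroF : ∀ n → F n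
zeroF zero = []
zeroF (suc n) = false ∷ zeroF n

APN : ∀ {n} → (F n → F n) → Set
APN {n} f = ∀ (a b : F n) → ¬' (a ≡ zeroF n) → nSol f a b ≤ 2
  where
  open import Data.Empty using (⊥)
  ¬' : Set → Set
  ¬' P = P → ⊥

ω : ∀ {n} → (F n → F n) → F n → ℕ
ω {n} f y = length (filter (λ x → f x ≟F y) (allF n))

InIm : ∀ {n} → (F n → F n) → F n → Set
InIm {n} f y = ∃ λ x → f x ≡ y

imSize : ∀ {n} → (F n → F n) → ℕ
imSize {n} f = length (filter (λ y → Data.List.Relation.Unary.Any.any? (λ x → f x ≟F y) (allF n)) (allF n))
  where import Data.List.Relation.Unary.Any

Odd : ℕ → Set
Odd n = n % 2 ≡ 1

Even : ℕ → Set
Even n = n % 2 ≡ 0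

-- Write N = 2^n, I = |Im f|, and let ω range over the fibre sizes of f.  Sorting the pairs
-- (x, x') with f x = f x' by their difference a = x + x' shows Σ ω² = Σ_a #{x : f(x + a) = f x};
-- the term a = 0 is N and APN bounds every other term by 2, so Σ ω² ≤ 3N - 2.  The defect
-- E = Σ_{ω > 0} (ω - 2)(ω - 3)/2 is a natural number with 2E = Σ ω² - 5N + 6I, and as Σ ω² + N
-- is even the slack 3N - 2 - Σ ω² is 2t for some t ≥ 0; together 3I = N + 1 + E + t.  Thus
-- 3I ≥ N + 1, and 3I ≥ N + 2 for even n since then N + 1 ≡ 2 (mod 3).  In the extremal cases
-- E + t ≤ 1, so every fibre has size at most 4 and E = c₁ + c₄, where c_k counts the fibres
-- of size k; counting N = Σ ω once more gives c₂ + c₁ = 1 + t + 2c₄, and the few solutions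
-- of these two equations are exactly the listed fibre profiles.

module Submission where

open import Defs
open import Data.Nat using (ℕ; _+_; _*_; _^_; _≤_)
open import Data.Product using (Σ; ∃; _×_; _,_)
open import Data.Sum using (_⊎_)
open import Relation.Nullary using (¬_)
open import Relation.Binary.PropositionalEquality using (_≡_; _≢_)

open import Data.Bool using (true; false; if_then_else_)
open import Data.Bool.Properties using (xor-same)
open import Data.Empty using (⊥-elim)
open import Data.List using (List; []; _∷_; _++_; map; filter; length)
open import Data.List.Membership.Propositional using (_∈_)
open import Data.List.Membership.Propositional.Properties
  using (∈-map⁺; ∈-map⁻; ∈-++⁺ˡ; ∈-++⁺ʳ; ∈-filter⁺; ∈-filter⁻)
open import Data.List.Properties using (map-++; map-∘; length-++; length-map; length-filter; filter-some)
open import Data.List.Relation.Unary.All using (All; []; _∷_)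
import Data.List.Relation.Unary.All as All
open import Data.List.Relation.Unary.AllPairs using ([]; _∷_)
open import Data.List.Relation.Unary.Any using (here; there)
import Data.List.Relation.Unary.Any as Any
open import Data.List.Relation.Unary.Unique.Propositional using (Unique)
import Data.List.Relation.Unary.Unique.Propositional.Properties as Unique
open import Data.Nat using (zero; suc; z≤n; s≤s; _∸_; _%_; _/_; _≟_)
open import Data.Nat.DivMod using (m≡m%n+[m/n]*n; [m+kn]%n≡m%n; m*n%n≡0)
open import Data.Nat.ListAction using (sum)
open import Data.Nat.ListAction.Properties using (sum-++)
open import Data.Nat.Properties
open import Algebra.Properties.CommutativeSemigroup +-commutativeSemigroup using (interchange)
open import Data.Nat.Tactic.RingSolver using (solve-∀)
open import Data.Product using (proj₂)
open import Data.Sum using (inj₁; inj₂)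
import Data.Sum as Sum
open import Data.Vec using ([]; _∷_)
open import Data.Vec.Properties using (∷-injectiveˡ; ∷-injectiveʳ)
open import Level using (_⊔_)
open import Relation.Binary.Definitions using (DecidableEquality)
open import Relation.Binary.PropositionalEquality
  using (refl; sym; trans; cong; cong₂; subst; module ≡-Reasoning)
open import Relation.Nullary using (Dec; yes; no; does)
open import Relation.Unary using (Decidable)

𝟙 : ∀ {p} {P : Set p} → Dec P → ℕ
𝟙 d = if does d then 1 else 0

𝟙-yes : ∀ {p} {P : Set p} (d : Dec P) → P → 𝟙 d ≡ 1
𝟙-yes (yes _) _ = refl
𝟙-yes (no ¬p) p = ⊥-elim (¬p p)

𝟙-no : ∀ {p} {P : Set p} (d : Dec P) → ¬ P → 𝟙 d ≡ 0
𝟙-no (yes p) ¬p = ⊥-elim (¬p p)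
𝟙-no (no _) _ = refl

𝟙-cong : ∀ {p q} {P : Set p} {Q : Set q} (d : Dec P) (e : Dec Q) →
         (P → Q) → (Q → P) → 𝟙 d ≡ 𝟙 e
𝟙-cong (yes p) e to _ = sym (𝟙-yes e (to p))
𝟙-cong (no ¬p) e _ from = sym (𝟙-no e (λ q → ¬p (from q)))

positive : ℕ → ℕ
positive zero = 0
positive (suc _) = 1

∑ : ∀ {a} {A : Set a} → List A → (A → ℕ) → ℕ
∑ xs g = sum (map g xs)

infix 5 ∑
syntax ∑ xs (λ x → e) = ∑[ x ∈ xs ] e

module _ {a} {A : Set a} where

  ∑-cong : ∀ (xs : List A) {g h : A → ℕ} → (∀ x → g x ≡ h x) → ∑ xs g ≡ ∑ xs h
  ∑-cong [] _ = refl
  ∑-cong (x ∷ xs) g≡h = cong₂ _+_ (g≡h x) (∑-cong xs g≡h)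

  ∑-mono-≤ : ∀ (xs : List A) {g h : A → ℕ} → (∀ x → g x ≤ h x) → ∑ xs g ≤ ∑ xs h
  ∑-mono-≤ [] _ = z≤n
  ∑-mono-≤ (x ∷ xs) g≤h = +-mono-≤ (g≤h x) (∑-mono-≤ xs g≤h)

  ∑-+ : ∀ (xs : List A) (g h : A → ℕ) → ∑[ x ∈ xs ] (g x + h x) ≡ ∑ xs g + ∑ xs h
  ∑-+ [] g h = refl
  ∑-+ (x ∷ xs) g h = begin
    g x + h x + (∑[ y ∈ xs ] g y + h y) ≡⟨ cong (g x + h x +_) (∑-+ xs g h) ⟩
    g x + h x + (∑ xs g + ∑ xs h)       ≡⟨ interchange (g x) (h x) _ _ ⟩
    (g x + ∑ xs g) + (h x + ∑ xs h)     ∎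
    where open ≡-Reasoning

  ∑-*ˡ : ∀ c (xs : List A) (g : A → ℕ) → ∑[ x ∈ xs ] c * g x ≡ c * ∑ xs g
  ∑-*ˡ c [] g = sym (*-zeroʳ c)
  ∑-*ˡ c (x ∷ xs) g = trans (cong (c * g x +_) (∑-*ˡ c xs g)) (sym (*-distribˡ-+ c (g x) _))

  ∑-const : ∀ c (xs : List A) → ∑[ _ ∈ xs ] c ≡ length xs * c
  ∑-const c [] = refl
  ∑-const c (x ∷ xs) = cong (c +_) (∑-const c xs)

  ∑-++ : ∀ (xs ys : List A) (g : A → ℕ) → ∑ (xs ++ ys) g ≡ ∑ xs g + ∑ ys g
  ∑-++ xs ys g = trans (cong sum (map-++ g xs ys)) (sum-++ (map g xs) (map g ys))

  ∈⇒≤∑ : ∀ {xs : List A} {x} → x ∈ xs → (g : A → ℕ) → g x ≤ ∑ xs g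
  ∈⇒≤∑ (here refl) g = m≤m+n _ _
  ∈⇒≤∑ {y ∷ _} (there x∈xs) g = ≤-trans (∈⇒≤∑ x∈xs g) (m≤n+m _ (g y))

  ∑≡0 : ∀ (xs : List A) {g : A → ℕ} → All (λ x → g x ≡ 0) xs → ∑ xs g ≡ 0
  ∑≡0 [] [] = refl
  ∑≡0 (x ∷ xs) (gx≡0 ∷ rest) = cong₂ _+_ gx≡0 (∑≡0 xs rest)

  length-filter≡∑ : ∀ {p} {P : A → Set p} (P? : Decidable P) (xs : List A) →
                    length (filter P? xs) ≡ ∑[ x ∈ xs ] 𝟙 (P? x)
  length-filter≡∑ P? [] = refl
  length-filter≡∑ P? (x ∷ xs) with P? x
  ... | yes _ = cong suc (length-filter≡∑ P? xs)
  ... | no _ = length-filter≡∑ P? xs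

  𝟙-any? : ∀ {p} {P : A → Set p} (P? : Decidable P) (xs : List A) →
           𝟙 (Any.any? P? xs) ≡ positive (length (filter P? xs))
  𝟙-any? P? [] = refl
  𝟙-any? P? (x ∷ xs) with P? x
  ... | yes _ = refl
  ... | no _ = 𝟙-any? P? xs

  ∑-pick : (_≟_ : DecidableEquality A) {xs : List A} → Unique xs → ∀ {c} → c ∈ xs →
           (g : A → ℕ) → ∑[ y ∈ xs ] 𝟙 (c ≟ y) * g y ≡ g c
  ∑-pick _≟_ {c ∷ xs} (c∉xs ∷ _) (here refl) g = begin
    𝟙 (c ≟ c) * g c + (∑[ y ∈ xs ] 𝟙 (c ≟ y) * g y)
      ≡⟨ cong₂ (λ u v → u * g c + v) (𝟙-yes (c ≟ c) refl) (∑≡0 xs (All.map vanish c∉xs)) ⟩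
    1 * g c + 0
      ≡⟨ trans (+-identityʳ _) (*-identityˡ _) ⟩
    g c ∎
    where
    open ≡-Reasoning
    vanish : ∀ {y} → c ≢ y → 𝟙 (c ≟ y) * g y ≡ 0
    vanish c≢y = cong (_* g _) (𝟙-no (c ≟ _) c≢y)
  ∑-pick _≟_ {x ∷ xs} (x∉xs ∷ unique) {c} (there c∈xs) g =
    trans (cong (λ u → u * g x + _) (𝟙-no (c ≟ x) λ { refl → All.lookup x∉xs c∈xs refl }))
          (∑-pick _≟_ unique c∈xs g)

∑-swap : ∀ {a b} {A : Set a} {B : Set b} (xs : List A) (ys : List B) (g : A → B → ℕ) →
         ∑[ x ∈ xs ] ∑[ y ∈ ys ] g x y ≡ ∑[ y ∈ ys ] ∑[ x ∈ xs ] g x y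
∑-swap [] ys g = sym (trans (∑-const 0 ys) (*-zeroʳ (length ys)))
∑-swap (x ∷ xs) ys g = trans (cong (∑ ys (g x) +_) (∑-swap xs ys g)) (sym (∑-+ ys (g x) _))

∑-*-∑ : ∀ {a b} {A : Set a} {B : Set b} (xs : List A) (ys : List B) (g : A → ℕ) (h : B → ℕ) →
        ∑ xs g * ∑ ys h ≡ ∑[ x ∈ xs ] ∑[ y ∈ ys ] g x * h y
∑-*-∑ [] ys g h = refl
∑-*-∑ (x ∷ xs) ys g h = trans (*-distribʳ-+ (∑ ys h) (g x) (∑ xs g))
                              (cong₂ _+_ (sym (∑-*ˡ (g x) ys h)) (∑-*-∑ xs ys g h))

length-filter≢0 : ∀ {a p} {A : Set a} {P : A → Set p} (P? : Decidable P) (xs : List A) →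
                  length (filter P? xs) ≢ 0 → ∃ P
length-filter≢0 P? [] ≢0 = ⊥-elim (≢0 refl)
length-filter≢0 P? (x ∷ xs) ≢0 with P? x
... | yes Px = x , Px
... | no _ = length-filter≢0 P? xs ≢0

∑-map : ∀ {a b} {A : Set a} {B : Set b} (h : A → B) (xs : List A) (g : B → ℕ) →
        ∑ (map h xs) g ≡ ∑[ x ∈ xs ] g (h x)
∑-map h xs g = cong sum (sym (map-∘ xs))

∈-allF : ∀ {n} (x : F n) → x ∈ allF n
∈-allF [] = here refl
∈-allF {suc n} (false ∷ x) = ∈-++⁺ˡ (∈-map⁺ (false ∷_) (∈-allF x))
∈-allF {suc n} (true ∷ x) = ∈-++⁺ʳ (map (false ∷_) (allF n)) (∈-map⁺ (true ∷_) (∈-allF x))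

allF-unique : ∀ n → Unique (allF n)
allF-unique zero = [] ∷ []
allF-unique (suc n) = Unique.++⁺ (Unique.map⁺ ∷-injectiveʳ (allF-unique n))
                                 (Unique.map⁺ ∷-injectiveʳ (allF-unique n))
                                 heads-differ
  where
  heads-differ : ∀ {v} → ¬ (v ∈ map (false ∷_) (allF n) × v ∈ map (true ∷_) (allF n))
  heads-differ (v∈l , v∈r) with ∈-map⁻ (false ∷_) v∈l | ∈-map⁻ (true ∷_) v∈r
  ... | _ , _ , refl | _ , _ , eq with ∷-injectiveˡ eq
  ... | ()

length-allF : ∀ n → length (allF n) ≡ 2 ^ n
length-allF zero = refl
length-allF (suc n) = begin
  length (map (false ∷_) (allF n) ++ map (true ∷_) (allF n))
    ≡⟨ length-++ (map (false ∷_) (allF n)) ⟩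
  length (map (false ∷_) (allF n)) + length (map (true ∷_) (allF n))
    ≡⟨ cong₂ _+_ (half false) (half true) ⟩
  2 ^ n + 2 ^ n
    ≡⟨ cong (2 ^ n +_) (sym (+-identityʳ _)) ⟩
  2 ^ suc n ∎
  where
  open ≡-Reasoning
  half : ∀ b → length (map (b ∷_) (allF n)) ≡ 2 ^ n
  half b = trans (length-map _ (allF n)) (length-allF n)

∑-allF-suc : ∀ n (g : F (suc n) → ℕ) →
             ∑ (allF (suc n)) g ≡ (∑[ x ∈ allF n ] g (false ∷ x)) + (∑[ x ∈ allF n ] g (true ∷ x))
∑-allF-suc n g = trans (∑-++ (map (false ∷_) (allF n)) _ g)
                       (cong₂ _+_ (∑-map _ (allF n) g) (∑-map _ (allF n) g))

∑-allF-⊕ : ∀ {n} (x : F n) (g : F n → ℕ) → ∑[ a ∈ allF n ] g (x ⊕ a) ≡ ∑ (allF n) g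
∑-allF-⊕ [] g = refl
∑-allF-⊕ {suc n} (false ∷ x) g = begin
  ∑[ a ∈ allF (suc n) ] g ((false ∷ x) ⊕ a)
    ≡⟨ ∑-allF-suc n _ ⟩
  (∑[ a ∈ allF n ] g (false ∷ x ⊕ a)) + (∑[ a ∈ allF n ] g (true ∷ x ⊕ a))
    ≡⟨ cong₂ _+_ (∑-allF-⊕ x (λ a → g (false ∷ a))) (∑-allF-⊕ x (λ a → g (true ∷ a))) ⟩
  (∑[ a ∈ allF n ] g (false ∷ a)) + (∑[ a ∈ allF n ] g (true ∷ a))
    ≡⟨ ∑-allF-suc n g ⟨
  ∑ (allF (suc n)) g ∎
  where open ≡-Reasoning
∑-allF-⊕ {suc n} (true ∷ x) g = begin
  ∑[ a ∈ allF (suc n) ] g ((true ∷ x) ⊕ a)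
    ≡⟨ ∑-allF-suc n _ ⟩
  (∑[ a ∈ allF n ] g (true ∷ x ⊕ a)) + (∑[ a ∈ allF n ] g (false ∷ x ⊕ a))
    ≡⟨ cong₂ _+_ (∑-allF-⊕ x (λ a → g (true ∷ a))) (∑-allF-⊕ x (λ a → g (false ∷ a))) ⟩
  (∑[ a ∈ allF n ] g (true ∷ a)) + (∑[ a ∈ allF n ] g (false ∷ a))
    ≡⟨ +-comm (∑[ a ∈ allF n ] g (true ∷ a)) _ ⟩
  (∑[ a ∈ allF n ] g (false ∷ a)) + (∑[ a ∈ allF n ] g (true ∷ a))
    ≡⟨ ∑-allF-suc n g ⟨
  ∑ (allF (suc n)) g ∎
  where open ≡-Reasoning

⊕-self : ∀ {n} (u : F n) → u ⊕ u ≡ zeroF n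
⊕-self [] = refl
⊕-self (b ∷ u) = cong₂ _∷_ (xor-same b) (⊕-self u)

⊕≡zero⇒≡ : ∀ {n} (u v : F n) → u ⊕ v ≡ zeroF n → u ≡ v
⊕≡zero⇒≡ [] [] _ = refl
⊕≡zero⇒≡ (false ∷ u) (false ∷ v) eq = cong (false ∷_) (⊕≡zero⇒≡ u v (∷-injectiveʳ eq))
⊕≡zero⇒≡ (true ∷ u) (true ∷ v) eq = cong (true ∷_) (⊕≡zero⇒≡ u v (∷-injectiveʳ eq))
⊕≡zero⇒≡ (false ∷ u) (true ∷ v) eq with ∷-injectiveˡ eq
... | ()
⊕≡zero⇒≡ (true ∷ u) (false ∷ v) eq with ∷-injectiveˡ eq
... | ()

record Enumerates {a p} {A : Set a} (P : A → Set p) (ys : List A) : Set (a ⊔ p) where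
  field
    unique : Unique ys
    sound : ∀ {y} → y ∈ ys → P y
    complete : ∀ {y} → P y → y ∈ ys

filter-allF-enumerates : ∀ {n p} {P : F n → Set p} (P? : Decidable P) →
                         Enumerates P (filter P? (allF n))
filter-allF-enumerates {n} P? = record
  { unique = Unique.filter⁺ P? (allF-unique n)
  ; sound = λ y∈ys → proj₂ (∈-filter⁻ P? {xs = allF n} y∈ys)
  ; complete = λ {y} Py → ∈-filter⁺ P? (∈-allF y) Py
  }

module _ {a p} {A : Set a} {P : A → Set p} where

  enumeration-empty : ∀ {ys} → Enumerates P ys → length ys ≡ 0 → ∀ y → ¬ P y
  enumeration-empty {[]} e _ y Py with Enumerates.complete e Py
  ... | ()

  enumeration-singleton : ∀ {ys} → Enumerates P ys → length ys ≡ 1 →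
                          Σ A λ y0 → P y0 × (∀ y → y ≢ y0 → ¬ P y)
  enumeration-singleton {y0 ∷ []} e _ = y0 , sound (here refl) , only-y0
    where
    open Enumerates e
    only-y0 : ∀ y → y ≢ y0 → ¬ P y
    only-y0 y y≢y0 Py with complete Py
    ... | here y≡y0 = y≢y0 y≡y0

  enumeration-pair : ∀ {ys} → Enumerates P ys → length ys ≡ 2 →
                     Σ A λ y0 → Σ A λ y1 → y0 ≢ y1 × P y0 × P y1 ×
                       (∀ y → y ≢ y0 → y ≢ y1 → ¬ P y)
  enumeration-pair {y0 ∷ y1 ∷ []} e _ with Enumerates.unique e
  ... | (y0≢y1 ∷ []) ∷ _ = y0 , y1 , y0≢y1 , sound (here refl) , sound (there (here refl)) , only
    where
    open Enumerates e
    only : ∀ y → y ≢ y0 → y ≢ y1 → ¬ P y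
    only y y≢y0 y≢y1 Py with complete Py
    ... | here y≡y0 = y≢y0 y≡y0
    ... | there (here y≡y1) = y≢y1 y≡y1

  enumeration-triple : ∀ {ys} → Enumerates P ys → length ys ≡ 3 →
                       Σ A λ y0 → Σ A λ y1 → Σ A λ y2 → y0 ≢ y1 × y0 ≢ y2 × y1 ≢ y2 ×
                         P y0 × P y1 × P y2 × (∀ y → y ≢ y0 → y ≢ y1 → y ≢ y2 → ¬ P y)
  enumeration-triple {y0 ∷ y1 ∷ y2 ∷ []} e _ with Enumerates.unique e
  ... | (y0≢y1 ∷ y0≢y2 ∷ []) ∷ (y1≢y2 ∷ []) ∷ _ =
    y0 , y1 , y2 , y0≢y1 , y0≢y2 , y1≢y2 ,
    sound (here refl) , sound (there (here refl)) , sound (there (there (here refl))) , only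
    where
    open Enumerates e
    only : ∀ y → y ≢ y0 → y ≢ y1 → y ≢ y2 → ¬ P y
    only y y≢y0 y≢y1 y≢y2 Py with complete Py
    ... | here y≡y0 = y≢y0 y≡y0
    ... | there (here y≡y1) = y≢y1 y≡y1
    ... | there (there (here y≡y2)) = y≢y2 y≡y2

∑-allF-pick : ∀ {n} (c : F n) (g : F n → ℕ) → ∑[ y ∈ allF n ] 𝟙 (c ≟F y) * g y ≡ g c
∑-allF-pick {n} c = ∑-pick _≟F_ (allF-unique n) (∈-allF c)

∑-allF-𝟙≟ : ∀ {n} (c : F n) → ∑[ y ∈ allF n ] 𝟙 (c ≟F y) ≡ 1
∑-allF-𝟙≟ {n} c = trans (∑-cong (allF n) λ y → sym (*-identityʳ (𝟙 (c ≟F y))))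
                        (∑-allF-pick c (λ _ → 1))

∑-allF-const : ∀ n c → ∑[ _ ∈ allF n ] c ≡ 2 ^ n * c
∑-allF-const n c = trans (∑-const c (allF n)) (cong (_* c) (length-allF n))

triangle : ℕ → ℕ
triangle zero = 0
triangle (suc k) = suc k + triangle k

triangle-double : ∀ k → 2 * triangle k ≡ k * k + k
triangle-double zero = refl
triangle-double (suc k) = begin
  2 * (suc k + triangle k)    ≡⟨ *-distribˡ-+ 2 (suc k) (triangle k) ⟩
  2 * suc k + 2 * triangle k  ≡⟨ cong (2 * suc k +_) (triangle-double k) ⟩
  2 * suc k + (k * k + k)     ≡⟨ square-suc k ⟩
  suc k * suc k + suc k       ∎
  where
  open ≡-Reasoning
  square-suc : ∀ k → 2 * suc k + (k * k + k) ≡ suc k * suc k + suc k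
  square-suc = solve-∀

-- (w - 2)(w - 3)/2 on nonempty fibres: a natural number, zero exactly for w = 2, 3.
defect : ℕ → ℕ
defect 0 = 0
defect 1 = 1
defect 2 = 0
defect (suc (suc (suc k))) = triangle k

defect-identity : ∀ w → 5 * w + 2 * defect w ≡ w * w + 6 * positive w
defect-identity 0 = refl
defect-identity 1 = refl
defect-identity 2 = refl
defect-identity (suc (suc (suc k))) = begin
  5 * (3 + k) + 2 * triangle k ≡⟨ cong (5 * (3 + k) +_) (triangle-double k) ⟩
  5 * (3 + k) + (k * k + k)    ≡⟨ expand k ⟩
  (3 + k) * (3 + k) + 6        ∎
  where
  open ≡-Reasoning
  expand : ∀ k → 5 * (3 + k) + (k * k + k) ≡ (3 + k) * (3 + k) + 6
  expand = solve-∀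

defect≤1⇒≤4 : ∀ w → defect w ≤ 1 → w ≤ 4
defect≤1⇒≤4 0 _ = z≤n
defect≤1⇒≤4 1 _ = s≤s z≤n
defect≤1⇒≤4 2 _ = s≤s (s≤s z≤n)
defect≤1⇒≤4 3 _ = s≤s (s≤s (s≤s z≤n))
defect≤1⇒≤4 4 _ = s≤s (s≤s (s≤s (s≤s z≤n)))
defect≤1⇒≤4 (suc (suc (suc (suc (suc k))))) (s≤s ())

defect-small : ∀ w → w ≤ 4 → defect w ≡ 𝟙 (w ≟ 1) + 𝟙 (w ≟ 4)
defect-small 0 _ = refl
defect-small 1 _ = refl
defect-small 2 _ = refl
defect-small 3 _ = refl
defect-small 4 _ = refl
defect-small (suc (suc (suc (suc (suc _))))) (s≤s (s≤s (s≤s (s≤s ()))))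

-- Summed over all fibres this becomes N + c₂ + 2c₁ = 3I + c₄.
fibre-balance-small : ∀ w → w ≤ 4 →
  w + 𝟙 (w ≟ 2) + 2 * 𝟙 (w ≟ 1) ≡ 3 * positive w + 𝟙 (w ≟ 4)
fibre-balance-small 0 _ = refl
fibre-balance-small 1 _ = refl
fibre-balance-small 2 _ = refl
fibre-balance-small 3 _ = refl
fibre-balance-small 4 _ = refl
fibre-balance-small (suc (suc (suc (suc (suc _))))) (s≤s (s≤s (s≤s (s≤s ()))))

≤4-remaining : ∀ {w} → w ≤ 4 → w ≢ 0 → w ≢ 1 → w ≢ 2 → w ≢ 4 → w ≡ 3
≤4-remaining {0} _ ≢0 _ _ _ = ⊥-elim (≢0 refl)
≤4-remaining {1} _ _ ≢1 _ _ = ⊥-elim (≢1 refl)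
≤4-remaining {2} _ _ _ ≢2 _ = ⊥-elim (≢2 refl)
≤4-remaining {3} _ _ _ _ _ = refl
≤4-remaining {4} _ _ _ _ ≢4 = ⊥-elim (≢4 refl)
≤4-remaining {suc (suc (suc (suc (suc _))))} (s≤s (s≤s (s≤s (s≤s ())))) _ _ _ _

even-gap : ∀ a b s → 2 * a ≡ 2 * b + s → Σ ℕ λ t → s ≡ 2 * t
even-gap a b s eq = a ∸ b , (begin
  s                   ≡⟨ m+n∸m≡n (2 * b) s ⟨
  2 * b + s ∸ 2 * b   ≡⟨ cong (_∸ 2 * b) eq ⟨
  2 * a ∸ 2 * b       ≡⟨ *-distribˡ-∸ 2 a b ⟨
  2 * (a ∸ b)         ∎)
  where open ≡-Reasoning

slack-even : ∀ {N Q H s} → Q + N ≡ 2 * H → Q + 2 + s ≡ 3 * N → Σ ℕ λ t → s ≡ 2 * t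
slack-even {N} {Q} {H} {s} parity slack = even-gap (2 * N) (H + 1) s (begin
  2 * (2 * N)        ≡⟨ split-4N N ⟩
  N + 3 * N          ≡⟨ cong (N +_) slack ⟨
  N + (Q + 2 + s)    ≡⟨ regroup N Q s ⟩
  Q + N + 2 + s      ≡⟨ cong (λ z → z + 2 + s) parity ⟩
  2 * H + 2 + s      ≡⟨ cong (_+ s) (*-distribˡ-+ 2 H 1) ⟨
  2 * (H + 1) + s    ∎)
  where
  open ≡-Reasoning
  split-4N : ∀ N → 2 * (2 * N) ≡ N + 3 * N
  split-4N = solve-∀
  regroup : ∀ N Q s → N + (Q + 2 + s) ≡ Q + N + 2 + s
  regroup = solve-∀

excess-from-counts : ∀ {N Q I E H} → 5 * N + 2 * E ≡ Q + 6 * I → Q + N ≡ 2 * H →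
                     Q + 2 ≤ 3 * N → Σ ℕ λ t → 3 * I ≡ N + 1 + (E + t)
excess-from-counts {N} {Q} {I} {E} {H} counts parity Q+2≤3N
  with s , slack ← m≤n⇒∃[o]m+o≡n Q+2≤3N
  with t , refl ← slack-even {H = H} {s = s} parity slack
  = t , *-cancelˡ-≡ (3 * I) _ 2 (+-cancelʳ-≡ (3 * N) _ _ (begin
    2 * (3 * I) + 3 * N              ≡⟨ cong (2 * (3 * I) +_) slack ⟨
    2 * (3 * I) + (Q + 2 + 2 * t)    ≡⟨ regroup-left I Q t ⟩
    Q + 6 * I + 2 + 2 * t            ≡⟨ cong (λ z → z + 2 + 2 * t) counts ⟨
    5 * N + 2 * E + 2 + 2 * t        ≡⟨ regroup-right N E t ⟩
    2 * (N + 1 + (E + t)) + 3 * N    ∎))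
  where
  open ≡-Reasoning
  regroup-left : ∀ I Q t → 2 * (3 * I) + (Q + 2 + 2 * t) ≡ Q + 6 * I + 2 + 2 * t
  regroup-left = solve-∀
  regroup-right : ∀ N E t → 5 * N + 2 * E + 2 + 2 * t ≡ 2 * (N + 1 + (E + t)) + 3 * N
  regroup-right = solve-∀

counts-at-excess-0 : ∀ {c₁ c₄ t c₂} → c₁ + c₄ + t ≡ 0 → c₂ + c₁ ≡ 1 + t + 2 * c₄ →
                     c₁ ≡ 0 × c₄ ≡ 0 × c₂ ≡ 1
counts-at-excess-0 {0} {0} {0} {c₂} _ eq = refl , refl , trans (sym (+-identityʳ c₂)) eq
counts-at-excess-0 {suc _} ()
counts-at-excess-0 {0} {suc _} ()
counts-at-excess-0 {0} {0} {suc _} ()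

counts-at-excess-1 : ∀ {c₁ c₄ t c₂} → c₁ + c₄ + t ≡ 1 → c₂ + c₁ ≡ 1 + t + 2 * c₄ →
                       (c₁ ≡ 1 × c₄ ≡ 0 × c₂ ≡ 0)
                     ⊎ (c₁ ≡ 0 × c₄ ≡ 0 × c₂ ≡ 2)
                     ⊎ (c₁ ≡ 0 × c₄ ≡ 1 × c₂ ≡ 3)
counts-at-excess-1 {1} {0} {0} {c₂} _ eq = inj₁ (refl , refl , +-cancelʳ-≡ 1 c₂ 0 eq)
counts-at-excess-1 {0} {0} {1} {c₂} _ eq = inj₂ (inj₁ (refl , refl , trans (sym (+-identityʳ c₂)) eq))
counts-at-excess-1 {0} {1} {0} {c₂} _ eq = inj₂ (inj₂ (refl , refl , trans (sym (+-identityʳ c₂)) eq))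
counts-at-excess-1 {suc (suc _)} ()
counts-at-excess-1 {1} {suc _} ()
counts-at-excess-1 {1} {0} {suc _} ()
counts-at-excess-1 {0} {suc (suc _)} ()
counts-at-excess-1 {0} {1} {suc _} ()
counts-at-excess-1 {0} {0} {suc (suc _)} ()
counts-at-excess-1 {0} {0} {0} ()

4^k≡1+3m : ∀ k → Σ ℕ λ m → 2 ^ (k * 2) ≡ 1 + m * 3
4^k≡1+3m zero = 0 , refl
4^k≡1+3m (suc k) with 4^k≡1+3m k
... | m , eq = 1 + 4 * m , (begin
  2 * (2 * 2 ^ (k * 2))    ≡⟨ cong (λ z → 2 * (2 * z)) eq ⟩
  2 * (2 * (1 + m * 3))    ≡⟨ expand m ⟩
  1 + (1 + 4 * m) * 3      ∎)
  where
  open ≡-Reasoning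
  expand : ∀ m → 2 * (2 * (1 + m * 3)) ≡ 1 + (1 + 4 * m) * 3
  expand = solve-∀

2^even≡1+3m : ∀ n → Even n → Σ ℕ λ m → 2 ^ n ≡ 1 + m * 3
2^even≡1+3m n even = subst (λ k → Σ ℕ λ m → 2 ^ k ≡ 1 + m * 3) (sym n≡n/2*2) (4^k≡1+3m (n / 2))
  where
  n≡n/2*2 : n ≡ (n / 2) * 2
  n≡n/2*2 = trans (m≡m%n+[m/n]*n n 2) (cong (_+ (n / 2) * 2) even)

*3≢2+*3 : ∀ a b → a * 3 ≢ 2 + b * 3
*3≢2+*3 a b eq with trans (sym (m*n%n≡0 a 3)) (trans (cong (_% 3) eq) ([m+kn]%n≡m%n 2 b 3))
... | ()

counts-balance : ∀ {N I c₁ c₂ c₄ t} → 3 * I ≡ N + 1 + (c₁ + c₄ + t) →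
                 N + c₂ + 2 * c₁ ≡ 3 * I + c₄ → c₂ + c₁ ≡ 1 + t + 2 * c₄
counts-balance {N} {I} {c₁} {c₂} {c₄} {t} excess balance = +-cancelˡ-≡ (N + c₁) _ _ (begin
  N + c₁ + (c₂ + c₁)             ≡⟨ regroup-left N c₁ c₂ ⟩
  N + c₂ + 2 * c₁                ≡⟨ balance ⟩
  3 * I + c₄                     ≡⟨ cong (_+ c₄) excess ⟩
  N + 1 + (c₁ + c₄ + t) + c₄     ≡⟨ regroup-right N c₁ c₄ t ⟩
  N + c₁ + (1 + t + 2 * c₄)      ∎)
  where
  open ≡-Reasoning
  regroup-left : ∀ N c₁ c₂ → N + c₁ + (c₂ + c₁) ≡ N + c₂ + 2 * c₁
  regroup-left = solve-∀
  regroup-right : ∀ N c₁ c₄ t → N + 1 + (c₁ + c₄ + t) + c₄ ≡ N + c₁ + (1 + t + 2 * c₄)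
  regroup-right = solve-∀

module _ {n : ℕ} (f : F n → F n) where

  collisions : ℕ
  collisions = ∑[ x ∈ allF n ] ∑[ x' ∈ allF n ] 𝟙 (f x' ≟F f x)

  fibres : ℕ → ℕ
  fibres k = length (filter (λ y → ω f y ≟ k) (allF n))

  defects : ℕ
  defects = ∑[ y ∈ allF n ] defect (ω f y)

  ω≡∑ : ∀ y → ω f y ≡ ∑[ x ∈ allF n ] 𝟙 (f x ≟F y)
  ω≡∑ y = length-filter≡∑ (λ x → f x ≟F y) (allF n)

  ∑ω≡2^n : ∑ (allF n) (ω f) ≡ 2 ^ n
  ∑ω≡2^n = begin
    ∑ (allF n) (ω f)                              ≡⟨ ∑-cong (allF n) ω≡∑ ⟩
    ∑[ y ∈ allF n ] ∑[ x ∈ allF n ] 𝟙 (f x ≟F y)  ≡⟨ ∑-swap (allF n) (allF n) _ ⟩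
    ∑[ x ∈ allF n ] ∑[ y ∈ allF n ] 𝟙 (f x ≟F y)  ≡⟨ ∑-cong (allF n) (λ x → ∑-allF-𝟙≟ (f x)) ⟩
    ∑[ x ∈ allF n ] 1                             ≡⟨ ∑-allF-const n 1 ⟩
    2 ^ n * 1                                     ≡⟨ *-identityʳ _ ⟩
    2 ^ n                                         ∎
    where open ≡-Reasoning

  ∑ω²≡collisions : ∑[ y ∈ allF n ] ω f y * ω f y ≡ collisions
  ∑ω²≡collisions = begin
    ∑[ y ∈ allF n ] ω f y * ω f y
      ≡⟨ ∑-cong (allF n) (λ y → trans (cong₂ _*_ (ω≡∑ y) (ω≡∑ y))
                                      (∑-*-∑ (allF n) (allF n) _ _)) ⟩
    ∑[ y ∈ allF n ] ∑[ x ∈ allF n ] ∑[ x' ∈ allF n ] 𝟙 (f x ≟F y) * 𝟙 (f x' ≟F y)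
      ≡⟨ ∑-swap (allF n) (allF n) _ ⟩
    ∑[ x ∈ allF n ] ∑[ y ∈ allF n ] ∑[ x' ∈ allF n ] 𝟙 (f x ≟F y) * 𝟙 (f x' ≟F y)
      ≡⟨ ∑-cong (allF n) (λ x → ∑-swap (allF n) (allF n) _) ⟩
    ∑[ x ∈ allF n ] ∑[ x' ∈ allF n ] ∑[ y ∈ allF n ] 𝟙 (f x ≟F y) * 𝟙 (f x' ≟F y)
      ≡⟨ ∑-cong (allF n) (λ x → ∑-cong (allF n) λ x' →
                                      ∑-allF-pick (f x) (λ y → 𝟙 (f x' ≟F y))) ⟩
    collisions ∎
    where open ≡-Reasoning

  nSol≡∑ : ∀ a → nSol f a (zeroF n) ≡ ∑[ x ∈ allF n ] 𝟙 (f (x ⊕ a) ≟F f x)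
  nSol≡∑ a = trans (length-filter≡∑ (λ x → (f (x ⊕ a) ⊕ f x) ≟F zeroF n) (allF n))
                   (∑-cong (allF n) λ x →
                     𝟙-cong ((f (x ⊕ a) ⊕ f x) ≟F zeroF n) (f (x ⊕ a) ≟F f x)
                            (⊕≡zero⇒≡ (f (x ⊕ a)) (f x))
                            (λ eq → trans (cong (_⊕ f x) eq) (⊕-self (f x))))

  ∑nSol≡collisions : ∑[ a ∈ allF n ] nSol f a (zeroF n) ≡ collisions
  ∑nSol≡collisions = begin
    ∑[ a ∈ allF n ] nSol f a (zeroF n)
      ≡⟨ ∑-cong (allF n) nSol≡∑ ⟩
    ∑[ a ∈ allF n ] ∑[ x ∈ allF n ] 𝟙 (f (x ⊕ a) ≟F f x)
      ≡⟨ ∑-swap (allF n) (allF n) _ ⟩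
    ∑[ x ∈ allF n ] ∑[ a ∈ allF n ] 𝟙 (f (x ⊕ a) ≟F f x)
      ≡⟨ ∑-cong (allF n) (λ x → ∑-allF-⊕ x (λ x' → 𝟙 (f x' ≟F f x))) ⟩
    collisions ∎
    where open ≡-Reasoning

  -- Each a ≠ 0 contributes at most 2 pairs, and a = 0 contributes the 2^n diagonal pairs.
  collisions-bound : APN f → collisions + 2 ≤ 3 * 2 ^ n
  collisions-bound apn = begin
    collisions + 2
      ≡⟨ cong₂ (λ u v → u + 2 * v) ∑nSol≡collisions (∑-allF-𝟙≟ (zeroF n)) ⟨
    ∑ (allF n) sol + 2 * ∑ (allF n) at0
      ≡⟨ trans (∑-+ (allF n) sol _) (cong (∑ (allF n) sol +_) (∑-*ˡ 2 (allF n) at0)) ⟨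
    ∑[ a ∈ allF n ] sol a + 2 * at0 a
      ≤⟨ ∑-mono-≤ (allF n) pointwise ⟩
    ∑[ a ∈ allF n ] 2 + 2 ^ n * at0 a
      ≡⟨ trans (∑-+ (allF n) _ _) (cong₂ _+_ (∑-allF-const n 2) (∑-*ˡ (2 ^ n) (allF n) at0)) ⟩
    2 ^ n * 2 + 2 ^ n * ∑ (allF n) at0
      ≡⟨ cong (λ v → 2 ^ n * 2 + 2 ^ n * v) (∑-allF-𝟙≟ (zeroF n)) ⟩
    2 ^ n * 2 + 2 ^ n * 1
      ≡⟨ trans (sym (*-distribˡ-+ (2 ^ n) 2 1)) (*-comm (2 ^ n) 3) ⟩
    3 * 2 ^ n ∎
    where
    open ≤-Reasoning
    sol at0 : F n → ℕ
    sol a = nSol f a (zeroF n)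
    at0 a = 𝟙 (zeroF n ≟F a)
    pointwise : ∀ a → nSol f a (zeroF n) + 2 * 𝟙 (zeroF n ≟F a) ≤ 2 + 2 ^ n * 𝟙 (zeroF n ≟F a)
    pointwise a with zeroF n ≟F a
    ... | yes refl = begin
      sol a + 2      ≤⟨ +-monoˡ-≤ 2 (≤-trans (length-filter _ (allF n)) (≤-reflexive (length-allF n))) ⟩
      2 ^ n + 2      ≡⟨ +-comm (2 ^ n) 2 ⟩
      2 + 2 ^ n      ≡⟨ cong (2 +_) (*-identityʳ (2 ^ n)) ⟨
      2 + 2 ^ n * 1  ∎
    ... | no 0≢a = begin
      sol a + 0      ≡⟨ +-identityʳ (sol a) ⟩
      sol a          ≤⟨ apn a (zeroF n) (λ a≡0 → 0≢a (sym a≡0)) ⟩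
      2              ≤⟨ m≤m+n 2 _ ⟩
      2 + 2 ^ n * 0  ∎

  imSize≡∑ : imSize f ≡ ∑[ y ∈ allF n ] positive (ω f y)
  imSize≡∑ = trans (length-filter≡∑ _ (allF n))
                   (∑-cong (allF n) λ y → 𝟙-any? (λ x → f x ≟F y) (allF n))

  InIm⇒ω≢0 : ∀ {y} → InIm f y → ω f y ≢ 0
  InIm⇒ω≢0 (x , refl) =
    n>0⇒n≢0 (filter-some (λ x' → f x' ≟F f x) (Any.map (λ x≡x' → cong f (sym x≡x')) (∈-allF x)))

  ω≢0⇒InIm : ∀ {y} → ω f y ≢ 0 → InIm f y
  ω≢0⇒InIm {y} = length-filter≢0 (λ x → f x ≟F y) (allF n)

  ∑-defect-identity : 5 * 2 ^ n + 2 * defects ≡ collisions + 6 * imSize f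
  ∑-defect-identity = begin
    5 * 2 ^ n + 2 * defects
      ≡⟨ cong₂ _+_ (trans (∑-*ˡ 5 (allF n) (ω f)) (cong (5 *_) ∑ω≡2^n)) (∑-*ˡ 2 (allF n) _) ⟨
    (∑[ y ∈ allF n ] 5 * ω f y) + (∑[ y ∈ allF n ] 2 * defect (ω f y))
      ≡⟨ ∑-+ (allF n) _ _ ⟨
    ∑[ y ∈ allF n ] 5 * ω f y + 2 * defect (ω f y)
      ≡⟨ ∑-cong (allF n) (λ y → defect-identity (ω f y)) ⟩
    ∑[ y ∈ allF n ] ω f y * ω f y + 6 * positive (ω f y)
      ≡⟨ ∑-+ (allF n) _ _ ⟩
    (∑[ y ∈ allF n ] ω f y * ω f y) + (∑[ y ∈ allF n ] 6 * positive (ω f y))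
      ≡⟨ cong₂ _+_ ∑ω²≡collisions (trans (∑-*ˡ 6 (allF n) _) (cong (6 *_) (sym imSize≡∑))) ⟩
    collisions + 6 * imSize f ∎
    where open ≡-Reasoning

  collisions+2^n-even : collisions + 2 ^ n ≡ 2 * (∑[ y ∈ allF n ] triangle (ω f y))
  collisions+2^n-even = begin
    collisions + 2 ^ n
      ≡⟨ cong₂ _+_ ∑ω²≡collisions ∑ω≡2^n ⟨
    (∑[ y ∈ allF n ] ω f y * ω f y) + ∑ (allF n) (ω f)
      ≡⟨ ∑-+ (allF n) _ _ ⟨
    ∑[ y ∈ allF n ] ω f y * ω f y + ω f y
      ≡⟨ ∑-cong (allF n) (λ y → triangle-double (ω f y)) ⟨
    ∑[ y ∈ allF n ] 2 * triangle (ω f y)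
      ≡⟨ ∑-*ˡ 2 (allF n) _ ⟩
    2 * (∑[ y ∈ allF n ] triangle (ω f y)) ∎
    where open ≡-Reasoning

  imSize-excess : APN f → Σ ℕ λ t → 3 * imSize f ≡ 2 ^ n + 1 + (defects + t)
  imSize-excess apn = excess-from-counts {I = imSize f} {H = ∑[ y ∈ allF n ] triangle (ω f y)}
                        ∑-defect-identity collisions+2^n-even (collisions-bound apn)

  imSize-lower-bound : APN f → 2 ^ n + 1 ≤ 3 * imSize f
  imSize-lower-bound apn with t , excess ← imSize-excess apn =
    ≤-trans (m≤m+n (2 ^ n + 1) (defects + t)) (≤-reflexive (sym excess))

  imSize-lower-bound-even : APN f → Even n → 2 ^ n + 2 ≤ 3 * imSize f
  imSize-lower-bound-even apn even with m , 2^n≡1+3m ← 2^even≡1+3m n even =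
    subst (_≤ 3 * imSize f) (sym (+-suc (2 ^ n) 1)) (≤∧≢⇒< (imSize-lower-bound apn) ≢3I)
    where
    ≢3I : 2 ^ n + 1 ≢ 3 * imSize f
    ≢3I eq = *3≢2+*3 (imSize f) m (begin
      imSize f * 3     ≡⟨ *-comm (imSize f) 3 ⟩
      3 * imSize f     ≡⟨ eq ⟨
      2 ^ n + 1        ≡⟨ cong (_+ 1) 2^n≡1+3m ⟩
      1 + m * 3 + 1    ≡⟨ +-comm (1 + m * 3) 1 ⟩
      2 + m * 3        ∎)
      where open ≡-Reasoning

  fibres≡∑ : ∀ k → fibres k ≡ ∑[ y ∈ allF n ] 𝟙 (ω f y ≟ k)
  fibres≡∑ k = length-filter≡∑ (λ y → ω f y ≟ k) (allF n)

  defects≤1⇒ω≤4 : defects ≤ 1 → ∀ y → ω f y ≤ 4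
  defects≤1⇒ω≤4 defects≤1 y =
    defect≤1⇒≤4 (ω f y) (≤-trans (∈⇒≤∑ (∈-allF y) (λ y → defect (ω f y))) defects≤1)

  module _ (bounded : ∀ y → ω f y ≤ 4) where

    defects≡fibres : defects ≡ fibres 1 + fibres 4
    defects≡fibres = begin
      defects
        ≡⟨ ∑-cong (allF n) (λ y → defect-small (ω f y) (bounded y)) ⟩
      ∑[ y ∈ allF n ] 𝟙 (ω f y ≟ 1) + 𝟙 (ω f y ≟ 4)
        ≡⟨ ∑-+ (allF n) _ _ ⟩
      (∑[ y ∈ allF n ] 𝟙 (ω f y ≟ 1)) + (∑[ y ∈ allF n ] 𝟙 (ω f y ≟ 4))
        ≡⟨ cong₂ _+_ (fibres≡∑ 1) (fibres≡∑ 4) ⟨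
      fibres 1 + fibres 4 ∎
      where open ≡-Reasoning

    fibres-balance : 2 ^ n + fibres 2 + 2 * fibres 1 ≡ 3 * imSize f + fibres 4
    fibres-balance = begin
      2 ^ n + fibres 2 + 2 * fibres 1
        ≡⟨ cong₂ (λ u v → u + v + 2 * fibres 1) (sym ∑ω≡2^n) (fibres≡∑ 2) ⟩
      ∑ (allF n) (ω f) + ∑ (allF n) is2 + 2 * fibres 1
        ≡⟨ cong (∑ (allF n) (ω f) + ∑ (allF n) is2 +_)
                (trans (cong (2 *_) (fibres≡∑ 1)) (sym (∑-*ˡ 2 (allF n) is1))) ⟩
      ∑ (allF n) (ω f) + ∑ (allF n) is2 + (∑[ y ∈ allF n ] 2 * is1 y)
        ≡⟨ trans (∑-+ (allF n) _ _) (cong (_+ (∑[ y ∈ allF n ] 2 * is1 y)) (∑-+ (allF n) (ω f) is2)) ⟨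
      ∑[ y ∈ allF n ] ω f y + is2 y + 2 * is1 y
        ≡⟨ ∑-cong (allF n) (λ y → fibre-balance-small (ω f y) (bounded y)) ⟩
      ∑[ y ∈ allF n ] 3 * positive (ω f y) + 𝟙 (ω f y ≟ 4)
        ≡⟨ ∑-+ (allF n) _ _ ⟩
      (∑[ y ∈ allF n ] 3 * positive (ω f y)) + (∑[ y ∈ allF n ] 𝟙 (ω f y ≟ 4))
        ≡⟨ cong₂ _+_ (trans (∑-*ˡ 3 (allF n) _) (cong (3 *_) (sym imSize≡∑))) (sym (fibres≡∑ 4)) ⟩
      3 * imSize f + fibres 4 ∎
      where
      open ≡-Reasoning
      is1 is2 : F n → ℕ
      is1 y = 𝟙 (ω f y ≟ 1)
      is2 y = 𝟙 (ω f y ≟ 2)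

  record FibreBalance (e : ℕ) : Set where
    field
      bounded : ∀ y → ω f y ≤ 4
      slack : ℕ
      excess : fibres 1 + fibres 4 + slack ≡ e
      balance : fibres 2 + fibres 1 ≡ 1 + slack + 2 * fibres 4

  fibre-balance : APN f → ∀ {e} → e ≤ 1 → 3 * imSize f ≡ 2 ^ n + 1 + e → FibreBalance e
  fibre-balance apn {e} e≤1 3I≡ with t , 3I≡′ ← imSize-excess apn = record
    { bounded = bounded
    ; slack = t
    ; excess = trans (cong (_+ t) (sym (defects≡fibres bounded))) defects+t≡e
    ; balance = counts-balance {N = 2 ^ n} {I = imSize f}
                  (trans 3I≡′ (cong (λ E → 2 ^ n + 1 + (E + t)) (defects≡fibres bounded)))
                  (fibres-balance bounded)
    }
    where
    defects+t≡e : defects + t ≡ e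
    defects+t≡e = +-cancelˡ-≡ (2 ^ n + 1) _ _ (trans (sym 3I≡′) 3I≡)
    bounded : ∀ y → ω f y ≤ 4
    bounded = defects≤1⇒ω≤4 (≤-trans (m≤m+n defects t) (≤-trans (≤-reflexive defects+t≡e) e≤1))

  no-fibres : ∀ k → fibres k ≡ 0 → ∀ y → ω f y ≢ k
  no-fibres k = enumeration-empty (filter-allF-enumerates (λ y → ω f y ≟ k))

  ω≡suc⇒InIm : ∀ {y k} → ω f y ≡ suc k → InIm f y
  ω≡suc⇒InIm ωy≡ = ω≢0⇒InIm (λ ωy≡0 → 1+n≢0 (trans (sym ωy≡) ωy≡0))

  different-sizes : ∀ {y y' k k'} → ω f y ≡ k → ω f y' ≡ k' → k ≢ k' → y ≢ y'
  different-sizes ωy≡k ωy'≡k' k≢k' y≡y' = k≢k' (trans (sym ωy≡k) (trans (cong (ω f) y≡y') ωy'≡k'))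

  ExceptionalFibres-2 : Set
  ExceptionalFibres-2 = Σ (F n) λ y0 → InIm f y0 × ω f y0 ≡ 2
    × (∀ y → InIm f y → y ≢ y0 → ω f y ≡ 3)

  ExceptionalFibres-1 : Set
  ExceptionalFibres-1 = Σ (F n) λ y0 → InIm f y0 × ω f y0 ≡ 1
    × (∀ y → InIm f y → y ≢ y0 → ω f y ≡ 3)

  ExceptionalFibres-22 : Set
  ExceptionalFibres-22 = Σ (F n) λ y0 → Σ (F n) λ y1 → y0 ≢ y1
    × InIm f y0 × InIm f y1 × ω f y0 ≡ 2 × ω f y1 ≡ 2
    × (∀ y → InIm f y → y ≢ y0 → y ≢ y1 → ω f y ≡ 3)

  ExceptionalFibres-2224 : Set
  ExceptionalFibres-2224 = Σ (F n) λ y0 → Σ (F n) λ y1 → Σ (F n) λ y2 → Σ (F n) λ y3 →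
    y0 ≢ y1 × y0 ≢ y2 × y1 ≢ y2 × y3 ≢ y0 × y3 ≢ y1 × y3 ≢ y2
    × InIm f y0 × InIm f y1 × InIm f y2 × InIm f y3
    × ω f y0 ≡ 2 × ω f y1 ≡ 2 × ω f y2 ≡ 2 × ω f y3 ≡ 4
    × (∀ y → InIm f y → y ≢ y0 → y ≢ y1 → y ≢ y2 → y ≢ y3 → ω f y ≡ 3)

  module _ (bounded : ∀ y → ω f y ≤ 4) where

    size-3 : ∀ {y} → InIm f y → ω f y ≢ 1 → ω f y ≢ 2 → ω f y ≢ 4 → ω f y ≡ 3
    size-3 {y} y∈Im = ≤4-remaining (bounded y) (InIm⇒ω≢0 y∈Im)

    exceptional-2 : fibres 1 ≡ 0 → fibres 4 ≡ 0 → fibres 2 ≡ 1 → ExceptionalFibres-2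
    exceptional-2 no1 no4 one2
      with y0 , ωy0≡2 , only-y0 ← enumeration-singleton (filter-allF-enumerates (λ y → ω f y ≟ 2)) one2
      = y0 , ω≡suc⇒InIm ωy0≡2 , ωy0≡2 ,
        λ y y∈Im y≢y0 → size-3 y∈Im (no-fibres 1 no1 y) (only-y0 y y≢y0) (no-fibres 4 no4 y)

    exceptional-1 : fibres 1 ≡ 1 → fibres 4 ≡ 0 → fibres 2 ≡ 0 → ExceptionalFibres-1
    exceptional-1 one1 no4 no2
      with y0 , ωy0≡1 , only-y0 ← enumeration-singleton (filter-allF-enumerates (λ y → ω f y ≟ 1)) one1
      = y0 , ω≡suc⇒InIm ωy0≡1 , ωy0≡1 ,
        λ y y∈Im y≢y0 → size-3 y∈Im (only-y0 y y≢y0) (no-fibres 2 no2 y) (no-fibres 4 no4 y)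

    exceptional-22 : fibres 1 ≡ 0 → fibres 4 ≡ 0 → fibres 2 ≡ 2 → ExceptionalFibres-22
    exceptional-22 no1 no4 two2
      with y0 , y1 , y0≢y1 , ωy0≡2 , ωy1≡2 , only
             ← enumeration-pair (filter-allF-enumerates (λ y → ω f y ≟ 2)) two2
      = y0 , y1 , y0≢y1 , ω≡suc⇒InIm ωy0≡2 , ω≡suc⇒InIm ωy1≡2 , ωy0≡2 , ωy1≡2 ,
        λ y y∈Im y≢y0 y≢y1 → size-3 y∈Im (no-fibres 1 no1 y) (only y y≢y0 y≢y1) (no-fibres 4 no4 y)

    exceptional-2224 : fibres 1 ≡ 0 → fibres 4 ≡ 1 → fibres 2 ≡ 3 → ExceptionalFibres-2224
    exceptional-2224 no1 one4 three2
      with y0 , y1 , y2 , y0≢y1 , y0≢y2 , y1≢y2 , ωy0≡2 , ωy1≡2 , ωy2≡2 , only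
             ← enumeration-triple (filter-allF-enumerates (λ y → ω f y ≟ 2)) three2
      with y3 , ωy3≡4 , only-y3 ← enumeration-singleton (filter-allF-enumerates (λ y → ω f y ≟ 4)) one4
      = y0 , y1 , y2 , y3 , y0≢y1 , y0≢y2 , y1≢y2 ,
        different-sizes ωy3≡4 ωy0≡2 (λ ()) , different-sizes ωy3≡4 ωy1≡2 (λ ()) ,
        different-sizes ωy3≡4 ωy2≡2 (λ ()) ,
        ω≡suc⇒InIm ωy0≡2 , ω≡suc⇒InIm ωy1≡2 , ω≡suc⇒InIm ωy2≡2 , ω≡suc⇒InIm ωy3≡4 ,
        ωy0≡2 , ωy1≡2 , ωy2≡2 , ωy3≡4 ,
        λ y y∈Im y≢y0 y≢y1 y≢y2 y≢y3 →
          size-3 y∈Im (no-fibres 1 no1 y) (only y y≢y0 y≢y1 y≢y2) (only-y3 y y≢y3)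

  extremal-odd : APN f → 3 * imSize f ≡ 2 ^ n + 1 → ExceptionalFibres-2
  extremal-odd apn 3I≡ =
    let no1 , no4 , one2 = counts-at-excess-0 excess balance in exceptional-2 bounded no1 no4 one2
    where open FibreBalance (fibre-balance apn z≤n (trans 3I≡ (sym (+-identityʳ (2 ^ n + 1)))))

  extremal-even : APN f → 3 * imSize f ≡ 2 ^ n + 2 →
                  ExceptionalFibres-1 ⊎ ExceptionalFibres-22 ⊎ ExceptionalFibres-2224
  extremal-even apn 3I≡ =
    Sum.map (λ (one1 , no4 , no2) → exceptional-1 bounded one1 no4 no2)
            (Sum.map (λ (no1 , no4 , two2) → exceptional-22 bounded no1 no4 two2)
                     (λ (no1 , one4 , three2) → exceptional-2224 bounded no1 one4 three2))
            (counts-at-excess-1 excess balance)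
    where open FibreBalance (fibre-balance apn ≤-refl (trans 3I≡ (sym (+-assoc (2 ^ n) 1 1))))

theorem4p2 : (n : ℕ) → 1 ≤ n → (f : F n → F n) → APN f →
    ((Odd n → 2 ^ n + 1 ≤ 3 * imSize f)
    × (Even n → 2 ^ n + 2 ≤ 3 * imSize f))
  × (Odd n → 3 * imSize f ≡ 2 ^ n + 1 →
      Σ (F n) λ y0 → InIm f y0 × ω f y0 ≡ 2
        × (∀ y → InIm f y → y ≢ y0 → ω f y ≡ 3))
  × (Even n → 3 * imSize f ≡ 2 ^ n + 2 →
      (Σ (F n) λ y0 → InIm f y0 × ω f y0 ≡ 1
        × (∀ y → InIm f y → y ≢ y0 → ω f y ≡ 3))
      ⊎ (Σ (F n) λ y0 → Σ (F n) λ y1 → y0 ≢ y1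
        × InIm f y0 × InIm f y1 × ω f y0 ≡ 2 × ω f y1 ≡ 2
        × (∀ y → InIm f y → y ≢ y0 → y ≢ y1 → ω f y ≡ 3))
      ⊎ (Σ (F n) λ y0 → Σ (F n) λ y1 → Σ (F n) λ y2 → Σ (F n) λ y3 →
        y0 ≢ y1 × y0 ≢ y2 × y1 ≢ y2 × y3 ≢ y0 × y3 ≢ y1 × y3 ≢ y2
        × InIm f y0 × InIm f y1 × InIm f y2 × InIm f y3
        × ω f y0 ≡ 2 × ω f y1 ≡ 2 × ω f y2 ≡ 2 × ω f y3 ≡ 4
        × (∀ y → InIm f y → y ≢ y0 → y ≢ y1 → y ≢ y2 → y ≢ y3 → ω f y ≡ 3)))
theorem4p2 n _ f apn =
  ((λ _ → imSize-lower-bound f apn) , imSize-lower-bound-even f apn) ,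
  (λ _ → extremal-odd f apn) ,
  (λ _ → extremal-even f apn)
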